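{- Every bipartite graph of minimum degree at least 2 has a majority edge coloring with 3 colors.
   Context: Graphs are finite, simple and undirected. A majority edge coloring is an edge coloring such that for every vertex $u$ and every color $\alpha$, at most half of the edges incident with $u$ have color $\alpha$ (it need not be proper). -}

module Defs where

open import Data.Nat using (ℕ; zero; suc; _+_; _*_; _≤_)
open import Data.Fin using (Fin; zero; suc)
open import Data.Bool using (Bool; true; false)
open import Data.Product using (Σ; ∃; _×_; _,_)
open import Relation.Nullary using (¬_)
open import Relation.Binary.PropositionalEquality using (_≡_; _≢_)

count : ∀ {n} → (Fin n → Bool) → ℕ
count {zero} f = 0
count {suc n} f with f zero
... | true  = suc (count (λ i → f (suc i)))
... | false = count (λ i → f (suc i))

record Graph (n : ℕ) : Set where
  field
    adj      : Fin n → Fin n → Bool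
    symmetric : ∀ u v → adj u v ≡ adj v u
    irreflexive : ∀ u → adj u u ≡ false
open Graph public

degree : ∀ {n} → Graph n → Fin n → ℕ
degree G u = count (λ v → adj G u v)

minDegreeAtLeast : ∀ {n} → Graph n → ℕ → Set
minDegreeAtLeast G k = ∀ u → k ≤ degree G u

Bipartite : ∀ {n} → Graph n → Set
Bipartite {n} G = Σ (Fin n → Bool) λ side →
  ∀ u v → adj G u v ≡ true → side u ≢ side v

-- An edge colouring with k colours: a symmetric function on pairs of vertices
-- (its values on non-adjacent pairs are irrelevant).
record EdgeColoring {n} (G : Graph n) (k : ℕ) : Set where
  field
    colour    : Fin n → Fin n → Fin k
    colour-sym : ∀ u v → colour u v ≡ colour v u
open EdgeColoring public

_==ᶠ_ : ∀ {k} → Fin k → Fin k → Bool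
zero ==ᶠ zero = true
zero ==ᶠ suc _ = false
suc _ ==ᶠ zero = false
suc a ==ᶠ suc b = a ==ᶠ b

_∧_ : Bool → Bool → Bool
true ∧ b = b
false ∧ _ = false

colourDegree : ∀ {n k} {G : Graph n} → EdgeColoring G k → Fin n → Fin k → ℕ
colourDegree {G = G} c u α = count (λ v → adj G u v ∧ (colour c u v ==ᶠ α))

IsMajority : ∀ {n k} {G : Graph n} → EdgeColoring G k → Set
IsMajority {G = G} c = ∀ u α → 2 * colourDegree c u α ≤ degree G u

{-# OPTIONS --safe #-}
-- Number the d(u) ≥ 2 neighbours of each vertex u and cut them into consecutive groups of three;
-- there are ⌈d(u)/3⌉ ≤ ⌊d(u)/2⌋ groups. Splitting every vertex into its groups turns G into a
-- bipartite multigraph of maximum degree 3, which by König's edge-colouring theorem has a proper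
-- 3-edge-colouring (built greedily, repairing conflicts by swapping colours on a Kempe chain).
-- Pulled back to G, every colour occurs at most once per group, so at most ⌊d(u)/2⌋ times at u.
module Submission where

open import Defs
open import Data.Nat
  using (ℕ; zero; suc; _+_; _*_; _≤_; _<_; z≤n; s≤s; _<?_; ⌊_/2⌋; ⌈_/2⌉; NonZero)
import Data.Nat.Properties as ℕ
open import Data.Nat.Properties
  using (≤-trans; <-≤-trans; <-irrefl; 1+n≰n; m≤n⇒m≤1+n; m≤n⇒m<n∨m≡n; m<1+n⇒m<n∨m≡n;
         m<1+n⇒m≤n; +-identityʳ; +-monoʳ-≤; *-monoʳ-≤; ⌊n/2⌋≤⌈n/2⌉; ⌊n/2⌋+⌈n/2⌉≡n)
open import Data.Nat.DivMod using (_/_; _%_; _mod_; m≡m%n+[m/n]*n; m<n*o⇒m/o<n)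
open import Data.Fin using (Fin; zero; suc; toℕ; fromℕ<; combine; remQuot)
open import Data.Fin.Properties
  using (_≟_; suc-injective; toℕ-injective; toℕ-fromℕ<; toℕ<n; toℕ≤pred[n]; injective⇒≤;
         any?; all?; ¬∀⟶∃¬;
         remQuot-combine; combine-remQuot; combine-injectiveˡ; combine-injectiveʳ)
open import Data.Fin.Permutation.Components using (transpose; transpose-inverse)
open import Data.Bool using (Bool; true; false; not; if_then_else_)
import Data.Bool.Properties as Bool
open import Data.Product using (Σ; ∃; _×_; _,_; proj₁; proj₂; swap; uncurry; map₂)
open import Data.Product.Properties using (≡-dec; ,-injective)
open import Data.Sum using (_⊎_; inj₁; inj₂)
open import Data.Empty using (⊥-elim)
open import Data.Vec.Functional using (updateAt)
open import Data.Vec.Functional.Properties using (updateAt-updates; updateAt-minimal)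
open import Function using (_∘_; const)
open import Level using (0ℓ)
open import Relation.Binary using (DecidableEquality)
open import Relation.Binary.PropositionalEquality
open import Relation.Nullary using (¬_; Dec; yes; no; does; _×-dec_; _⊎-dec_)
open import Relation.Nullary.Decidable using (map′)
open import Relation.Unary using (Pred; Decidable; _⊆_; _∪_; ｛_｝)

enumerate : ∀ {n} (f : Fin n → Bool) → Fin (count f) → Fin n
enumerate {suc n} f i with f zero
enumerate {suc n} f zero    | true  = zero
enumerate {suc n} f (suc i) | true  = suc (enumerate (f ∘ suc) i)
enumerate {suc n} f i       | false = suc (enumerate (f ∘ suc) i)

enumerate-true : ∀ {n} (f : Fin n → Bool) i → f (enumerate f i) ≡ true
enumerate-true {suc n} f i with f zero in f0
enumerate-true {suc n} f zero    | true  = f0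
enumerate-true {suc n} f (suc i) | true  = enumerate-true (f ∘ suc) i
enumerate-true {suc n} f i       | false = enumerate-true (f ∘ suc) i

enumerate-injective : ∀ {n} (f : Fin n → Bool) {i j} → enumerate f i ≡ enumerate f j → i ≡ j
enumerate-injective {suc n} f {i} {j} eq with f zero
enumerate-injective {suc n} f {zero}  {zero}  eq | true = refl
enumerate-injective {suc n} f {zero}  {suc j} () | true
enumerate-injective {suc n} f {suc i} {zero}  () | true
enumerate-injective {suc n} f {suc i} {suc j} eq | true =
  cong suc (enumerate-injective (f ∘ suc) (suc-injective eq))
enumerate-injective {suc n} f {i}     {j}     eq | false =
  enumerate-injective (f ∘ suc) (suc-injective eq)

injective⇒count≤ : ∀ {n p} (f : Fin n → Bool) (g : Fin n → ℕ) →
  (∀ {i} → f i ≡ true → g i < p) →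
  (∀ {i j} → f i ≡ true → f j ≡ true → g i ≡ g j → i ≡ j) →
  count f ≤ p
injective⇒count≤ f g g<p g-injective = injective⇒≤ {f = h} h-injective
  where
  h : Fin (count f) → Fin _
  h i = fromℕ< (g<p (enumerate-true f i))
  h-injective : ∀ {i j} → h i ≡ h j → i ≡ j
  h-injective {i} {j} eq = enumerate-injective f
    (g-injective (enumerate-true f i) (enumerate-true f j)
      (trans (sym (toℕ-fromℕ< _)) (trans (cong toℕ eq) (toℕ-fromℕ< _))))

position : ∀ {n} → (Fin n → Bool) → Fin n → ℕ
position f zero = 0
position f (suc i) with f zero
... | true  = suc (position (f ∘ suc) i)
... | false = position (f ∘ suc) i

position<count : ∀ {n} (f : Fin n → Bool) {i} → f i ≡ true → position f i < count f
position<count f {zero} fi rewrite fi = s≤s z≤n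
position<count f {suc i} fi with f zero
... | true  = s≤s (position<count (f ∘ suc) fi)
... | false = position<count (f ∘ suc) fi

position-injective : ∀ {n} (f : Fin n → Bool) {i j} → f i ≡ true → f j ≡ true →
  position f i ≡ position f j → i ≡ j
position-injective f {zero}  {zero}  _  _  _  = refl
position-injective f {zero}  {suc j} f0 _  eq with f zero
... | true  with () ← eq
... | false with () ← f0
position-injective f {suc i} {zero}  _  f0 eq with f zero
... | true  with () ← eq
... | false with () ← f0
position-injective f {suc i} {suc j} fi fj eq with f zero
... | true  = cong suc (position-injective (f ∘ suc) fi fj (ℕ.suc-injective eq))
... | false = cong suc (position-injective (f ∘ suc) fi fj eq)

2*⌊n/2⌋≤n : ∀ n → 2 * ⌊ n /2⌋ ≤ n
2*⌊n/2⌋≤n n = begin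
  2 * ⌊ n /2⌋         ≡⟨ cong (⌊ n /2⌋ +_) (+-identityʳ ⌊ n /2⌋) ⟩
  ⌊ n /2⌋ + ⌊ n /2⌋   ≤⟨ +-monoʳ-≤ ⌊ n /2⌋ (⌊n/2⌋≤⌈n/2⌉ n) ⟩
  ⌊ n /2⌋ + ⌈ n /2⌉   ≡⟨ ⌊n/2⌋+⌈n/2⌉≡n n ⟩
  n                   ∎
  where open ℕ.≤-Reasoning

n≤1+⌊n/2⌋*3 : ∀ n → n ≤ suc (⌊ n /2⌋ * 3)
n≤1+⌊n/2⌋*3 zero          = z≤n
n≤1+⌊n/2⌋*3 (suc zero)    = s≤s z≤n
n≤1+⌊n/2⌋*3 (suc (suc n)) = s≤s (s≤s (m≤n⇒m≤1+n (n≤1+⌊n/2⌋*3 n)))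

n≤⌊n/2⌋*3 : ∀ {n} → 2 ≤ n → n ≤ ⌊ n /2⌋ * 3
n≤⌊n/2⌋*3 {suc zero}    (s≤s ())
n≤⌊n/2⌋*3 {suc (suc n)} _ = s≤s (s≤s (n≤1+⌊n/2⌋*3 n))

div-mod-injective : ∀ {a b} n .{{_ : NonZero n}} → a / n ≡ b / n → a mod n ≡ b mod n → a ≡ b
div-mod-injective {a} {b} n quot rem = begin
  a                 ≡⟨ m≡m%n+[m/n]*n a n ⟩
  a % n + a / n * n ≡⟨ cong₂ (λ r q → r + q * n) rem′ quot ⟩
  b % n + b / n * n ≡⟨ m≡m%n+[m/n]*n b n ⟨
  b                 ∎
  where
  open ≡-Reasoning
  rem′ : a % n ≡ b % n
  rem′ = trans (sym (toℕ-fromℕ< _)) (trans (cong toℕ rem) (toℕ-fromℕ< _))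

transpose-matchˡ : ∀ {n} (i j : Fin n) → transpose i j i ≡ j
transpose-matchˡ i j with i ≟ i
... | yes _   = refl
... | no i≢i = ⊥-elim (i≢i refl)

transpose-matchʳ : ∀ {n} (i j : Fin n) → transpose i j j ≡ i
transpose-matchʳ i j with j ≟ i
... | yes j≡i = j≡i
... | no _ with j ≟ j
...   | yes _   = refl
...   | no j≢j = ⊥-elim (j≢j refl)

transpose-injective : ∀ {n} (i j : Fin n) {a b} → transpose i j a ≡ transpose i j b → a ≡ b
transpose-injective i j {a} {b} eq = begin
  a                               ≡⟨ transpose-inverse j i ⟨
  transpose j i (transpose i j a) ≡⟨ cong (transpose j i) eq ⟩
  transpose j i (transpose i j b) ≡⟨ transpose-inverse j i ⟩
  b                               ∎
  where open ≡-Reasoning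

∧-true : ∀ {a b} → a ∧ b ≡ true → a ≡ true × b ≡ true
∧-true {true} b = refl , b

==ᶠ-sound : ∀ {k} {a b : Fin k} → (a ==ᶠ b) ≡ true → a ≡ b
==ᶠ-sound {a = zero}  {zero}  _  = refl
==ᶠ-sound {a = zero}  {suc _} ()
==ᶠ-sound {a = suc _} {zero}  ()
==ᶠ-sound {a = suc a} {suc b} eq = cong suc (==ᶠ-sound eq)

-- A bipartite multigraph with edges Fin m, the edge e joining the left vertex left e to the right
-- vertex right e; a left and a right vertex are different vertices even when they are equal in V.
module König {m k : ℕ} {V : Set} (_≟ᵥ_ : DecidableEquality V)
  (Edge : Pred (Fin m) 0ℓ) (Edge? : Decidable Edge) (left right : Fin m → V) where

  Colouring : Set
  Colouring = Fin m → Fin k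

  ProperAt : (Fin m → V) → Pred (Fin m) 0ℓ → Colouring → Set
  ProperAt end D col = ∀ {e f} → D e → D f → end e ≡ end f → col e ≡ col f → e ≡ f

  Proper : Pred (Fin m) 0ℓ → Colouring → Set
  Proper D col = ProperAt left D col × ProperAt right D col

  Proper-⊆ : ∀ {D D′ col} → D′ ⊆ D → Proper D col → Proper D′ col
  Proper-⊆ D′⊆D (properˡ , properʳ) =
    (λ De Df → properˡ (D′⊆D De) (D′⊆D Df)) , (λ De Df → properʳ (D′⊆D De) (D′⊆D Df))

  Present : (Fin m → V) → Pred (Fin m) 0ℓ → Colouring → V → Fin k → Set
  Present end D col x c = ∃ λ e → D e × end e ≡ x × col e ≡ c

  Missing : (Fin m → V) → Pred (Fin m) 0ℓ → Colouring → V → Fin k → Set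
  Missing end D col x c = ¬ Present end D col x c

  present? : ∀ {D} → Decidable D → ∀ end col x c → Dec (Present end D col x c)
  present? D? end col x c = any? λ e → D? e ×-dec (end e ≟ᵥ x) ×-dec (col e ≟ c)

  -- If all k colours were present at end e₀, then e₀ and one edge of each colour would be k + 1
  -- edges there with pairwise distinct labels in Fin k.
  missing-colour : ∀ {end label D} → Decidable D → ProperAt end Edge label → D ⊆ Edge →
    ∀ col {e₀} → Edge e₀ → ¬ D e₀ → ∃ (Missing end D col (end e₀))
  missing-colour {end} {label} {D} D? proper D⊆Edge col {e₀} Ee₀ e₀∉D
    with all? (present? D? end col (end e₀))
  ... | no ¬all = ¬∀⟶∃¬ k _ (present? D? end col (end e₀)) ¬all
  ... | yes all = ⊥-elim (1+n≰n (injective⇒≤ {f = labelOf} labelOf-injective))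
    where
    labelOf : Fin (suc k) → Fin k
    labelOf zero    = label e₀
    labelOf (suc c) = label (proj₁ (all c))

    new≢old : ∀ c → label e₀ ≢ labelOf (suc c)
    new≢old c same with all c
    ... | e , De , at , _ = e₀∉D (subst D (sym (proper Ee₀ (D⊆Edge De) (sym at) same)) De)

    labelOf-injective : ∀ {c c′} → labelOf c ≡ labelOf c′ → c ≡ c′
    labelOf-injective {zero}  {zero}   _    = refl
    labelOf-injective {zero}  {suc c}  same = ⊥-elim (new≢old c same)
    labelOf-injective {suc c} {zero}   same = ⊥-elim (new≢old c (sym same))
    labelOf-injective {suc c} {suc c′} same with all c | all c′
    ... | e , De , at , ce | e′ , De′ , at′ , ce′ =
      cong suc (trans (sym ce)
        (trans (cong col (proper (D⊆Edge De) (D⊆Edge De′) (trans at (sym at′)) same)) ce′))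

  module Swap (α β : Fin k) where

    IsAB : Fin k → Set
    IsAB c = c ≡ α ⊎ c ≡ β

    transpose-IsAB : ∀ {c} → IsAB c → IsAB (transpose α β c)
    transpose-IsAB (inj₁ refl) = inj₂ (transpose-matchˡ α β)
    transpose-IsAB (inj₂ refl) = inj₁ (transpose-matchʳ α β)

    swapOn : ∀ {W : Pred (Fin m) 0ℓ} → Decidable W → Colouring → Colouring
    swapOn W? col e = if does (W? e) then transpose α β (col e) else col e

    swapOn-∈ : ∀ {W e} (W? : Decidable W) col → W e → swapOn W? col e ≡ transpose α β (col e)
    swapOn-∈ {e = e} W? col e∈ with W? e
    ... | yes _  = refl
    ... | no e∉ = ⊥-elim (e∉ e∈)

    swapOn-∉ : ∀ {W e} (W? : Decidable W) col → ¬ W e → swapOn W? col e ≡ col e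
    swapOn-∉ {e = e} W? col e∉ with W? e
    ... | yes e∈ = ⊥-elim (e∉ e∈)
    ... | no _   = refl

    swapOn-proper : ∀ {end D col W} (W? : Decidable W) → ProperAt end D col →
      (∀ {e} → W e → IsAB (col e)) →
      (∀ {e f} → W e → D f → end e ≡ end f → IsAB (col f) → W f) →
      ProperAt end D (swapOn W? col)
    swapOn-proper {col = col} W? proper W-IsAB W-closed {e} {f} De Df same eq with W? e | W? f
    ... | yes _  | yes _  = proper De Df same (transpose-injective α β eq)
    ... | no _   | no _   = proper De Df same eq
    ... | yes e∈ | no f∉ =
      ⊥-elim (f∉ (W-closed e∈ Df same (subst IsAB eq (transpose-IsAB (W-IsAB e∈)))))
    ... | no e∉  | yes f∈ =
      ⊥-elim (e∉ (W-closed f∈ De (sym same) (subst IsAB (sym eq) (transpose-IsAB (W-IsAB f∈)))))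

  -- Reach j e: e is the j-th edge of the α/β-alternating path leaving y through the α-edge e₁.
  -- Swapping α and β on this path frees α at y, and the path never reaches x: each β-edge on it
  -- shares its left end with the preceding α-edge, and α is missing at x.
  module KempeChain {D : Pred (Fin m) 0ℓ} (D? : Decidable D) {col : Colouring} (proper : Proper D col)
    {α β : Fin k} {x y : V} (α-missing : Missing left D col x α) (β-missing : Missing right D col y β)
    {e₁ : Fin m} (De₁ : D e₁) (e₁-at-y : right e₁ ≡ y) (e₁-α : col e₁ ≡ α) where

    open Swap α β

    α≢β : α ≢ β
    α≢β refl = β-missing (e₁ , De₁ , e₁-at-y , e₁-α)

    Step : Fin m → Fin m → Set
    Step e f = D e × D f ×
      ((col e ≡ α × col f ≡ β × left e ≡ left f) ⊎
       (col e ≡ β × col f ≡ α × right e ≡ right f))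

    step? : ∀ e f → Dec (Step e f)
    step? e f = D? e ×-dec D? f ×-dec
      ((col e ≟ α ×-dec col f ≟ β ×-dec left e ≟ᵥ left f) ⊎-dec
       (col e ≟ β ×-dec col f ≟ α ×-dec right e ≟ᵥ right f))

    Reach : ℕ → Pred (Fin m) 0ℓ
    Reach zero    f = e₁ ≡ f
    Reach (suc j) f = ∃ λ e → Reach j e × Step e f

    reach? : ∀ j → Decidable (Reach j)
    reach? zero    f = e₁ ≟ f
    reach? (suc j) f = any? λ e → reach? j e ×-dec step? e f

    reach-D : ∀ {j e} → Reach j e → D e
    reach-D {zero}  refl                = De₁
    reach-D {suc j} (_ , _ , _ , De , _) = De

    reach-IsAB : ∀ {j e} → Reach j e → IsAB (col e)
    reach-IsAB {zero}  refl                                = inj₁ e₁-α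
    reach-IsAB {suc j} (_ , _ , _ , _ , inj₁ (_ , eβ , _)) = inj₂ eβ
    reach-IsAB {suc j} (_ , _ , _ , _ , inj₂ (_ , eα , _)) = inj₁ eα

    reach-avoids-x : ∀ {j e} → Reach j e → left e ≢ x
    reach-avoids-x {zero}  refl at-x = α-missing (e₁ , De₁ , at-x , e₁-α)
    reach-avoids-x {suc j} (_ , r , _ , _ , inj₁ (_ , _ , same)) at-x = reach-avoids-x r (trans same at-x)
    reach-avoids-x {suc j} (_ , _ , _ , De , inj₂ (_ , eα , _))   at-x = α-missing (_ , De , at-x , eα)

    step-injective : ∀ {e e′ f} → Step e f → Step e′ f → e ≡ e′
    step-injective (De , _ , inj₁ (eα , _ , same)) (De′ , _ , inj₁ (e′α , _ , same′)) =
      proj₁ proper De De′ (trans same (sym same′)) (trans eα (sym e′α))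
    step-injective (De , _ , inj₂ (eβ , _ , same)) (De′ , _ , inj₂ (e′β , _ , same′)) =
      proj₂ proper De De′ (trans same (sym same′)) (trans eβ (sym e′β))
    step-injective (_ , _ , inj₁ (_ , fβ , _)) (_ , _ , inj₂ (_ , fα , _)) =
      ⊥-elim (α≢β (trans (sym fα) fβ))
    step-injective (_ , _ , inj₂ (_ , fα , _)) (_ , _ , inj₁ (_ , fβ , _)) =
      ⊥-elim (α≢β (trans (sym fα) fβ))

    no-step-to-e₁ : ∀ {e} → ¬ Step e e₁
    no-step-to-e₁ (_ , _ , inj₁ (_ , e₁-β , _))   = α≢β (trans (sym e₁-α) e₁-β)
    no-step-to-e₁ (De , _ , inj₂ (eβ , _ , same)) = β-missing (_ , De , trans same e₁-at-y , eβ)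

    reach-injective : ∀ {i j e} → Reach i e → Reach j e → i ≡ j
    reach-injective {zero}  {zero}  _           _            = refl
    reach-injective {zero}  {suc j} refl        (_ , _ , s)  = ⊥-elim (no-step-to-e₁ s)
    reach-injective {suc i} {zero}  (_ , _ , s) refl         = ⊥-elim (no-step-to-e₁ s)
    reach-injective {suc i} {suc j} (_ , r , s) (_ , r′ , s′) with step-injective s s′
    ... | refl = cong suc (reach-injective r r′)

    reach-prefix : ∀ {i j e} → Reach j e → i ≤ j → ∃ (Reach i)
    reach-prefix {j = zero} r z≤n = _ , r
    reach-prefix {i} {suc j} r i≤1+j with m≤n⇒m<n∨m≡n i≤1+j
    ... | inj₁ i<1+j = reach-prefix (proj₁ (proj₂ r)) (m<1+n⇒m≤n i<1+j)
    ... | inj₂ refl  = _ , r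

    reach-bound : ∀ {j e} → Reach j e → j < m
    reach-bound {j} r = injective⇒≤ {f = proj₁ ∘ visited} visited-injective
      where
      visited : (i : Fin (suc j)) → ∃ (Reach (toℕ i))
      visited i = reach-prefix r (toℕ≤pred[n] i)
      visited-injective : ∀ {i i′} → proj₁ (visited i) ≡ proj₁ (visited i′) → i ≡ i′
      visited-injective {i} {i′} same = toℕ-injective
        (reach-injective (proj₂ (visited i))
          (subst (Reach (toℕ i′)) (sym same) (proj₂ (visited i′))))

    InChain : Pred (Fin m) 0ℓ
    InChain e = ∃ λ j → Reach j e

    inChain? : Decidable InChain
    inChain? e = map′ (λ (i , r) → toℕ i , r) bounded (any? λ i → reach? (toℕ i) e)
      where
      bounded : InChain e → ∃ λ (i : Fin m) → Reach (toℕ i) e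
      bounded (j , r) = fromℕ< (reach-bound r) , subst (λ j → Reach j e) (sym (toℕ-fromℕ< _)) r

    inChain-same-colour : ∀ {end e f} → ProperAt end D col → InChain e → D f →
      end e ≡ end f → col e ≡ col f → InChain f
    inChain-same-colour proper (j , r) Df same c = j , subst (Reach j) (proper (reach-D r) Df same c) r

    β-predecessor : ∀ {j e} → Reach j e → col e ≡ β →
      ∃ λ g → InChain g × col g ≡ α × left g ≡ left e
    β-predecessor {zero}  refl e₁-β = ⊥-elim (α≢β (trans (sym e₁-α) e₁-β))
    β-predecessor {suc j} (g , r , _ , _ , inj₁ (gα , _ , same)) _  = g , (j , r) , gα , same
    β-predecessor {suc j} (_ , _ , _ , _ , inj₂ (_ , eα , _))    eβ =
      ⊥-elim (α≢β (trans (sym eα) eβ))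

    α-predecessor : ∀ {j e} → Reach j e → col e ≡ α →
      e₁ ≡ e ⊎ ∃ λ g → InChain g × col g ≡ β × right g ≡ right e
    α-predecessor {zero}  r _ = inj₁ r
    α-predecessor {suc j} (_ , _ , _ , _ , inj₁ (_ , eβ , _))    eα =
      ⊥-elim (α≢β (trans (sym eα) eβ))
    α-predecessor {suc j} (g , r , _ , _ , inj₂ (gβ , _ , same)) _  = inj₂ (g , (j , r) , gβ , same)

    closedˡ : ∀ {e f} → InChain e → D f → left e ≡ left f → IsAB (col f) → InChain f
    closedˡ (j , r) Df same fc with reach-IsAB r | fc
    ... | inj₁ eα | inj₁ fα = inChain-same-colour (proj₁ proper) (j , r) Df same (trans eα (sym fα))
    ... | inj₂ eβ | inj₂ fβ = inChain-same-colour (proj₁ proper) (j , r) Df same (trans eβ (sym fβ))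
    ... | inj₁ eα | inj₂ fβ = suc j , _ , r , reach-D r , Df , inj₁ (eα , fβ , same)
    ... | inj₂ eβ | inj₁ fα with β-predecessor r eβ
    ...   | g , g∈ , gα , g-same =
      inChain-same-colour (proj₁ proper) g∈ Df (trans g-same same) (trans gα (sym fα))

    closedʳ : ∀ {e f} → InChain e → D f → right e ≡ right f → IsAB (col f) → InChain f
    closedʳ (j , r) Df same fc with reach-IsAB r | fc
    ... | inj₁ eα | inj₁ fα = inChain-same-colour (proj₂ proper) (j , r) Df same (trans eα (sym fα))
    ... | inj₂ eβ | inj₂ fβ = inChain-same-colour (proj₂ proper) (j , r) Df same (trans eβ (sym fβ))
    ... | inj₂ eβ | inj₁ fα = suc j , _ , r , reach-D r , Df , inj₂ (eβ , fα , same)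
    ... | inj₁ eα | inj₂ fβ with α-predecessor r eα
    ...   | inj₁ refl = ⊥-elim (β-missing (_ , Df , trans (sym same) e₁-at-y , fβ))
    ...   | inj₂ (g , g∈ , gβ , g-same) =
      inChain-same-colour (proj₂ proper) g∈ Df (trans g-same same) (trans gβ (sym fβ))

    recoloured : Colouring
    recoloured = swapOn inChain? col

    recoloured-proper : Proper D recoloured
    recoloured-proper = swapOn-proper inChain? (proj₁ proper) (reach-IsAB ∘ proj₂) closedˡ
                      , swapOn-proper inChain? (proj₂ proper) (reach-IsAB ∘ proj₂) closedʳ

    α-missing-at-x : Missing left D recoloured x α
    α-missing-at-x (e , De , at-x , eα) with inChain? e
    ... | yes (_ , r) = reach-avoids-x r at-x
    ... | no e∉       = α-missing (e , De , at-x , trans (sym (swapOn-∉ inChain? col e∉)) eα)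

    α-missing-at-y : Missing right D recoloured y α
    α-missing-at-y (e , De , at-y , eα) with inChain? e
    ... | yes e∈ = β-missing (e , De , at-y , transpose-injective α β
                     (trans (sym (swapOn-∈ inChain? col e∈)) (trans eα (sym (transpose-matchʳ α β)))))
    ... | no e∉  = e∉ (inChain-same-colour (proj₂ proper) (0 , refl) De (trans e₁-at-y (sym at-y))
                     (trans e₁-α (sym (trans (sym (swapOn-∉ inChain? col e∉)) eα))))

  extend : ∀ {end D col e₀ c} → ProperAt end D col → Missing end D col (end e₀) c → ¬ D e₀ →
    ProperAt end (D ∪ ｛ e₀ ｝) (updateAt col e₀ (const c))
  extend {end} {D} {col} {e₀} {c} proper c-missing e₀∉D = extended
    where
    unchanged : ∀ {e} → D e → updateAt col e₀ (const c) e ≡ col e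
    unchanged {e} De = updateAt-minimal e e₀ col (λ e≡e₀ → e₀∉D (subst D e≡e₀ De))

    updated : updateAt col e₀ (const c) e₀ ≡ c
    updated = updateAt-updates e₀ col

    extended : ProperAt end (D ∪ ｛ e₀ ｝) (updateAt col e₀ (const c))
    extended (inj₁ De)   (inj₁ Df)   same eq =
      proper De Df same (trans (sym (unchanged De)) (trans eq (unchanged Df)))
    extended (inj₁ De)   (inj₂ refl) same eq =
      ⊥-elim (c-missing (_ , De , same , trans (sym (unchanged De)) (trans eq updated)))
    extended (inj₂ refl) (inj₁ Df)   same eq =
      ⊥-elim (c-missing (_ , Df , sym same , trans (sym (unchanged Df)) (trans (sym eq) updated)))
    extended (inj₂ refl) (inj₂ refl) _    _  = refl

  colour-new-edge : ∀ {D col e₀ c} → ¬ D e₀ → Proper D col →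
    Missing left D col (left e₀) c → Missing right D col (right e₀) c →
    ∃ (Proper (D ∪ ｛ e₀ ｝))
  colour-new-edge e₀∉D (properˡ , properʳ) missingˡ missingʳ =
    _ , extend properˡ missingˡ e₀∉D , extend properʳ missingʳ e₀∉D

  Prefix : ℕ → Pred (Fin m) 0ℓ
  Prefix j e = Edge e × toℕ e < j

  -- Labellings injective on the edges at each left, resp. right, vertex: maximum degree at most k.
  module _ {labelˡ labelʳ : Colouring}
    (labelˡ-proper : ProperAt left Edge labelˡ) (labelʳ-proper : ProperAt right Edge labelʳ) where

    add-edge : ∀ {D col e₀} → Decidable D → D ⊆ Edge → Edge e₀ → ¬ D e₀ → Proper D col →
      ∃ (Proper (D ∪ ｛ e₀ ｝))
    add-edge {col = col} {e₀} D? D⊆Edge Ee₀ e₀∉D proper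
      with missing-colour D? labelˡ-proper D⊆Edge col Ee₀ e₀∉D
         | missing-colour D? labelʳ-proper D⊆Edge col Ee₀ e₀∉D
    ... | α , αˡ | β , βʳ with present? D? right col (right e₀) α
    ...   | no αʳ = colour-new-edge e₀∉D proper αˡ αʳ
    ...   | yes (_ , De₁ , e₁-at-y , e₁-α) =
      colour-new-edge e₀∉D K.recoloured-proper K.α-missing-at-x K.α-missing-at-y
      where module K = KempeChain D? proper αˡ βʳ De₁ e₁-at-y e₁-α

    colour-prefix : ∀ j → ∃ (Proper (Prefix j))
    colour-prefix zero = labelˡ , (λ { (_ , ()) }) , (λ { (_ , ()) })
    colour-prefix (suc j) with colour-prefix j | any? (λ e → Edge? e ×-dec toℕ e ℕ.≟ j)
    ... | col , proper | no none = col , Proper-⊆ old proper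
      where
      old : Prefix (suc j) ⊆ Prefix j
      old {e} (Ee , e<1+j) with m<1+n⇒m<n∨m≡n e<1+j
      ... | inj₁ e<j = Ee , e<j
      ... | inj₂ e≡j = ⊥-elim (none (e , Ee , e≡j))
    ... | _ , proper | yes (e₀ , Ee₀ , e₀≡j) =
      map₂ (Proper-⊆ old-or-new)
        (add-edge (λ e → Edge? e ×-dec toℕ e <? j) proj₁ Ee₀
          (λ (_ , e₀<j) → <-irrefl e₀≡j e₀<j) proper)
      where
      old-or-new : Prefix (suc j) ⊆ Prefix j ∪ ｛ e₀ ｝
      old-or-new {e} (Ee , e<1+j) with m<1+n⇒m<n∨m≡n e<1+j
      ... | inj₁ e<j = inj₁ (Ee , e<j)
      ... | inj₂ e≡j = inj₂ (toℕ-injective (trans e₀≡j (sym e≡j)))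

    proper-edge-colouring : ∃ (Proper Edge)
    proper-edge-colouring = map₂ (Proper-⊆ λ {e} Ee → Ee , toℕ<n e) (colour-prefix m)

module Grouping {n} (G : Graph n) where

  rank : Fin n → Fin n → ℕ
  rank u = position (adj G u)

  group : Fin n → Fin n → ℕ
  group u v = rank u v / 3

  slot : Fin n → Fin n → Fin 3
  slot u v = rank u v mod 3

  group<⌊degree/2⌋ : ∀ {u v} → 2 ≤ degree G u → adj G u v ≡ true → group u v < ⌊ degree G u /2⌋
  group<⌊degree/2⌋ {u} 2≤d uv =
    m<n*o⇒m/o<n (<-≤-trans (position<count (adj G u) uv) (n≤⌊n/2⌋*3 2≤d))

  group-slot-injective : ∀ {u v w} → adj G u v ≡ true → adj G u w ≡ true →
    group u v ≡ group u w → slot u v ≡ slot u w → v ≡ w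
  group-slot-injective {u} uv uw p s = position-injective (adj G u) uv uw (div-mod-injective 3 p s)

module Splitting {n} (G : Graph n) (side : Fin n → Bool)
  (bipartite : ∀ u v → adj G u v ≡ true → side u ≢ side v) where

  open Grouping G

  Arc : Set
  Arc = Fin n × Fin n

  Adjacent : Arc → Set
  Adjacent (u , v) = adj G u v ≡ true

  EdgeArc : Arc → Set
  EdgeArc (u , v) = Adjacent (u , v) × side u ≡ false

  edgeArc? : Decidable EdgeArc
  edgeArc? (u , v) = adj G u v Bool.≟ true ×-dec side u Bool.≟ false

  arc : Fin (n * n) → Arc
  arc = remQuot n

  tailGroup : Arc → Fin n × ℕ
  tailGroup (u , v) = u , group u v

  tailSlot : Arc → Fin 3
  tailSlot (u , v) = slot u v

  -- The split graph H: its edges are the edges of G, indexed by their arcs (u , v) with u on the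
  -- false side; such an edge joins the group of v at u (left) to the group of u at v (right).
  Edge : Pred (Fin (n * n)) 0ℓ
  Edge = EdgeArc ∘ arc

  left right : Fin (n * n) → Fin n × ℕ
  left  = tailGroup ∘ arc
  right = tailGroup ∘ swap ∘ arc

  labelˡ labelʳ : Fin (n * n) → Fin 3
  labelˡ = tailSlot ∘ arc
  labelʳ = tailSlot ∘ swap ∘ arc

  open König {k = 3} (≡-dec _≟_ ℕ._≟_) Edge (edgeArc? ∘ arc) left right

  arc-injective : ∀ {e f} → arc e ≡ arc f → e ≡ f
  arc-injective {e} {f} same =
    trans (sym (combine-remQuot {n} n e)) (trans (cong (uncurry combine) same) (combine-remQuot {n} n f))

  reverse-adjacent : ∀ {a} → Adjacent a → Adjacent (swap a)
  reverse-adjacent {u , v} uv = trans (symmetric G v u) uv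

  tail-injective : ∀ {a b} → Adjacent a → Adjacent b →
    tailGroup a ≡ tailGroup b → tailSlot a ≡ tailSlot b → a ≡ b
  tail-injective {u , v} {_ , w} uv uw same s with ,-injective same
  ... | refl , p = cong (u ,_) (group-slot-injective uv uw p s)

  labelˡ-proper : ProperAt left Edge labelˡ
  labelˡ-proper (uv , _) (uw , _) same s = arc-injective (tail-injective uv uw same s)

  labelʳ-proper : ProperAt right Edge labelʳ
  labelʳ-proper (uv , _) (uw , _) same s =
    arc-injective (cong swap (tail-injective (reverse-adjacent uv) (reverse-adjacent uw) same s))

  col : Fin (n * n) → Fin 3
  col = proj₁ (proper-edge-colouring labelˡ-proper labelʳ-proper)

  col-proper : Proper Edge col
  col-proper = proj₂ (proper-edge-colouring labelˡ-proper labelʳ-proper)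

  opposite-side : ∀ {u v} → adj G u v ≡ true → side v ≡ not (side u)
  opposite-side {u} {v} uv with side u | side v | bipartite u v uv
  ... | false | false | differ = ⊥-elim (differ refl)
  ... | false | true  | _      = refl
  ... | true  | false | _      = refl
  ... | true  | true  | differ = ⊥-elim (differ refl)

  edgeOf : Fin n → Fin n → Fin (n * n)
  edgeOf u v = if side u then combine v u else combine u v

  endAt : Fin n → Fin (n * n) → Fin n × ℕ
  endAt u = if side u then right else left

  edgeOf-edge : ∀ {u v} → adj G u v ≡ true → Edge (edgeOf u v)
  edgeOf-edge {u} {v} uv with side u in su
  ... | false = subst EdgeArc (sym (remQuot-combine u v)) (uv , su)
  ... | true  = subst EdgeArc (sym (remQuot-combine v u))
                  (reverse-adjacent uv , trans (opposite-side uv) (cong not su))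

  endAt-edgeOf : ∀ u v → endAt u (edgeOf u v) ≡ (u , group u v)
  endAt-edgeOf u v with side u
  ... | false = cong tailGroup (remQuot-combine u v)
  ... | true  = cong (tailGroup ∘ swap) (remQuot-combine v u)

  edgeOf-injective : ∀ {u v w} → edgeOf u v ≡ edgeOf u w → v ≡ w
  edgeOf-injective {u} {v} {w} same with side u
  ... | false = combine-injectiveʳ u v u w same
  ... | true  = combine-injectiveˡ v u w u same

  endAt-proper : ∀ u → ProperAt (endAt u) Edge col
  endAt-proper u with side u
  ... | false = proj₁ col-proper
  ... | true  = proj₂ col-proper

  edgeColour : Fin n → Fin n → Fin 3
  edgeColour u v with side u | side v
  ... | false | true  = col (combine u v)
  ... | true  | false = col (combine v u)
  ... | false | false = zero
  ... | true  | true  = zero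

  edgeColour-sym : ∀ u v → edgeColour u v ≡ edgeColour v u
  edgeColour-sym u v with side u | side v
  ... | false | true  = refl
  ... | true  | false = refl
  ... | false | false = refl
  ... | true  | true  = refl

  edgeColour-edgeOf : ∀ {u v} → adj G u v ≡ true → edgeColour u v ≡ col (edgeOf u v)
  edgeColour-edgeOf {u} {v} uv rewrite opposite-side uv with side u
  ... | false = refl
  ... | true  = refl

  colouring : EdgeColoring G 3
  colouring = record { colour = edgeColour ; colour-sym = edgeColour-sym }

  colourDegree≤⌊degree/2⌋ : minDegreeAtLeast G 2 → ∀ u α →
    colourDegree colouring u α ≤ ⌊ degree G u /2⌋
  colourDegree≤⌊degree/2⌋ δ u α =
    injective⇒count≤ _ (group u) (group<⌊degree/2⌋ (δ u) ∘ proj₁ ∘ ∧-true) same-group⇒same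
    where
    HasColour : Fin n → Set
    HasColour v = adj G u v ∧ (edgeColour u v ==ᶠ α) ≡ true

    same-group⇒same : ∀ {v w} → HasColour v → HasColour w → group u v ≡ group u w → v ≡ w
    same-group⇒same {v} {w} hv hw same-group with ∧-true hv | ∧-true hw
    ... | uv , vα | uw , wα =
      edgeOf-injective (endAt-proper u (edgeOf-edge uv) (edgeOf-edge uw) same-end same-colour)
      where
      same-end : endAt u (edgeOf u v) ≡ endAt u (edgeOf u w)
      same-end = trans (endAt-edgeOf u v) (trans (cong (u ,_) same-group) (sym (endAt-edgeOf u w)))

      same-colour : col (edgeOf u v) ≡ col (edgeOf u w)
      same-colour = begin
        col (edgeOf u v) ≡⟨ edgeColour-edgeOf uv ⟨
        edgeColour u v   ≡⟨ ==ᶠ-sound vα ⟩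
        α                ≡⟨ ==ᶠ-sound wα ⟨
        edgeColour u w   ≡⟨ edgeColour-edgeOf uw ⟩
        col (edgeOf u w) ∎
        where open ≡-Reasoning

  majority : minDegreeAtLeast G 2 → IsMajority colouring
  majority δ u α = ≤-trans (*-monoʳ-≤ 2 (colourDegree≤⌊degree/2⌋ δ u α)) (2*⌊n/2⌋≤n (degree G u))

corollary24 : (n : ℕ) (G : Graph n) → Bipartite G → minDegreeAtLeast G 2 →
    Σ (EdgeColoring G 3) IsMajority
corollary24 n G (side , bipartite) δ = colouring , majority δ
  where open Splitting G side bipartite
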